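{- Let $M=M_F$, let $\tau$ be a $2$-orientation of $M$, let $A\subseteq M$ be finite with $A\le_d M$, and let $B$ be the graph constructed from $A$ and $\tau$ as described in the context. Then $A\le_d B$, i.e.\ $\delta(A)<\delta(C)$ for every $A\subsetneq C\subseteq B$.
   Context: Graphs are simple; for a finite graph $A$, $\delta(A)=2|A|-|E_A|$, and subsets carry the induced subgraph structure. $F:\mathbb{R}_{\ge0}\to\mathbb{R}_{\ge0}$ is continuous, strictly increasing, piecewise smooth, $F(0)=0$, $F(x)\to\infty$, with decreasing right derivative, $F(1)=2$, $F(2)=3$, and $F'(x)\le 2/(8x+1)$ for $x\ge2$. $\mathcal{C}_{>0}$: finite graphs all of whose nonempty subgraphs have $\delta>0$; $A\le_d B$ means $\delta(A)<\delta(C)$ for all $A\subsetneq C\subseteq B$; $\mathcal{C}_F=\{B\in\mathcal{C}_{>0}:\delta(A)\ge F(|A|)\ \forall A\subseteq B\}$; $M_F$ is the Fraïssé limit of the amalgamation class $(\mathcal{C}_F,\le_d)$, and for finite $A\subseteq M_F$, $A\le_d M_F$ means $A\cap X\le_d X$ for all finite $X\subseteq M_F$. A $2$-orientation $\tau$ of $M$ contains exactly one of $(x,y),(y,x)$ for each edge $xy$ and nothing else, with every vertex having at most two out-neighbours. Let $\tau|_A=\tau\cap A^2$. The graph $B$ is defined as follows: $B$ contains $A$ as an induced subgraph; add a new vertex $c\notin A$; for each $(a,b)\in\tau|_A$ add four new distinct vertices $l_1^{(a,b)},l_2^{(a,b)},l_3^{(a,b)},l_4^{(a,b)}$ (all new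 vertices for different pairs distinct) and the edges $c\,l_1^{(a,b)}$, $l_1^{(a,b)}l_2^{(a,b)}$, $l_2^{(a,b)}l_3^{(a,b)}$, $l_3^{(a,b)}l_4^{(a,b)}$, $l_4^{(a,b)}l_1^{(a,b)}$, $l_2^{(a,b)}a$, $l_4^{(a,b)}a$, $l_3^{(a,b)}b$; there are no other edges. -}

module Defs where

open import Level using (0ℓ)
open import Data.Nat as ℕ using (ℕ; zero; suc)
open import Data.Integer as ℤ using (ℤ; +_)
open import Data.Fin using (Fin)
open import Data.List using (List; []; _∷_; length; map; filter; allFin; lookup)
open import Data.List.Membership.Propositional using (_∈_)
open import Data.List.Membership.DecPropositional (ℕ._≟_) using (_∈?_)
open import Data.List.Relation.Unary.Unique.Propositional using (Unique)
open import Data.List.Relation.Unary.All using (All)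
open import Data.List.Relation.Binary.Subset.Propositional using (_⊆_)
open import Data.Product using (Σ; ∃; _×_; _,_)
open import Data.Sum using (_⊎_)
open import Data.Unit using (⊤; tt)
open import Data.Empty using (⊥)
open import Function.Bundles using (_⇔_)
open import Function.Definitions using (Injective)
open import Relation.Nullary using (¬_; Dec; yes; no)
open import Relation.Nullary.Decidable using (_×-dec_)
open import Relation.Binary.PropositionalEquality using (_≡_; refl)

-- Graphs with a decidable adjacency relation on a vertex type V.
-- Finite vertex sets are duplicate-free lists (Unique), with the
-- induced subgraph structure.

record DecGraph (V : Set) : Set₁ where
  field
    Adj  : V → V → Set
    adj? : (x y : V) → Dec (Adj x y)
open DecGraph public

record Simple {V : Set} (G : DecGraph V) : Set where
  field
    sym    : ∀ {x y} → Adj G x y → Adj G y x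
    irrefl : ∀ {x} → ¬ Adj G x x

edges : {V : Set} → DecGraph V → List V → ℕ
edges G []       = 0
edges G (x ∷ xs) = length (filter (adj? G x) xs) ℕ.+ edges G xs

δ : {V : Set} → DecGraph V → List V → ℤ
δ G xs = + (2 ℕ.* length xs) ℤ.- + edges G xs

InCpos : {V : Set} → DecGraph V → List V → Set
InCpos G X = ∀ Y → Unique Y → Y ⊆ X → ¬ (Y ≡ []) → + 0 ℤ.< δ G Y

-- X ∈ C_F, where F is represented by its integer ceilings g n = ⌈F n⌉
-- (δ is an integer, so δ(Y) ≥ F(|Y|) iff δ(Y) ≥ ⌈F(|Y|)⌉).
InCF : (ℕ → ℕ) → {V : Set} → DecGraph V → List V → Set
InCF g G X = InCpos G X × (∀ Y → Unique Y → Y ⊆ X → + g (length Y) ℤ.≤ δ G Y)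

StrongIn : {V : Set} → DecGraph V → List V → List V → Set
StrongIn G A B =
  ∀ C → Unique C → A ⊆ C → ¬ (C ⊆ A) → C ⊆ B → δ G A ℤ.< δ G C

-- for M a graph on ℕ and finite A: A ≤_d M iff A ∩ X ≤_d X for all finite X
_∩_ : List ℕ → List ℕ → List ℕ
A ∩ X = filter (_∈? A) X

StrongInM : DecGraph ℕ → List ℕ → Set
StrongInM M A = ∀ X → Unique X → StrongIn M (A ∩ X) X

-- The Fraïssé limit M_F of (C_F, ≤_d), as a countable graph on ℕ,
-- characterised as the (C_F, ≤_d)-generic structure.

IsEmbedding : {n : ℕ} → DecGraph (Fin n) → DecGraph ℕ → (Fin n → ℕ) → Set
IsEmbedding GB M h =
  Injective _≡_ _≡_ h × (∀ x y → Adj GB x y ⇔ Adj M (h x) (h y))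

record IsFraisseLimit (g : ℕ → ℕ) (M : DecGraph ℕ) : Set₁ where
  field
    age       : ∀ X → Unique X → InCF g M X
    closure   : ∀ X → Unique X → Σ (List ℕ) λ Y → Unique Y × X ⊆ Y × StrongInM M Y
    rich      : ∀ (A : List ℕ) → Unique A → StrongInM M A →
                ∀ (n : ℕ) (GB : DecGraph (Fin n)) → Simple GB → InCF g GB (allFin n) →
                (i : Fin (length A) → Fin n) → Injective _≡_ _≡_ i →
                (∀ p q → Adj M (lookup A p) (lookup A q) ⇔ Adj GB (i p) (i q)) →
                StrongIn GB (map i (allFin (length A))) (allFin n) →
                Σ (Fin n → ℕ) λ h → IsEmbedding GB M h ×
                  (∀ p → h (i p) ≡ lookup A p) × StrongInM M (map h (allFin n))

-- discrete shadows of the conditions on F (for g n = ⌈F n⌉):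
-- F(0)=0, F(1)=2, F(2)=3, F increasing.
record AdmissibleCeil (g : ℕ → ℕ) : Set where
  field
    g0   : g 0 ≡ 0
    g1   : g 1 ≡ 2
    g2   : g 2 ≡ 3
    mono : ∀ m n → m ℕ.≤ n → g m ℕ.≤ g n

record TwoOrientation (M : DecGraph ℕ) (T : ℕ → ℕ → Set) : Set where
  field
    only-edges : ∀ {x y} → T x y → Adj M x y
    some-dir   : ∀ {x y} → Adj M x y → T x y ⊎ T y x
    not-both   : ∀ {x y} → T x y → T y x → ⊥
    outdeg≤2   : ∀ x (ys : List ℕ) → Unique ys → All (T x) ys → length ys ℕ.≤ 2

data Pos : Set where
  l₁ l₂ l₃ l₄ : Pos

-- vertices: old vertices a, the new vertex c, and l_i^{(a,b)}
data BV : Set where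
  old : ℕ → BV
  cen : BV
  gad : ℕ → ℕ → Pos → BV

CycAdj : Pos → Pos → Set
CycAdj l₁ l₂ = ⊤
CycAdj l₂ l₁ = ⊤
CycAdj l₂ l₃ = ⊤
CycAdj l₃ l₂ = ⊤
CycAdj l₃ l₄ = ⊤
CycAdj l₄ l₃ = ⊤
CycAdj l₄ l₁ = ⊤
CycAdj l₁ l₄ = ⊤
CycAdj _  _  = ⊥

cyc? : ∀ i j → Dec (CycAdj i j)
cyc? l₁ l₁ = no λ ()
cyc? l₁ l₂ = yes tt
cyc? l₁ l₃ = no λ ()
cyc? l₁ l₄ = yes tt
cyc? l₂ l₁ = yes tt
cyc? l₂ l₂ = no λ ()
cyc? l₂ l₃ = yes tt
cyc? l₂ l₄ = no λ ()
cyc? l₃ l₁ = no λ ()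
cyc? l₃ l₂ = yes tt
cyc? l₃ l₃ = no λ ()
cyc? l₃ l₄ = yes tt
cyc? l₄ l₁ = yes tt
cyc? l₄ l₂ = no λ ()
cyc? l₄ l₃ = yes tt
cyc? l₄ l₄ = no λ ()

GadOld : ℕ → ℕ → Pos → ℕ → Set
GadOld a b l₁ x = ⊥
GadOld a b l₂ x = x ≡ a
GadOld a b l₃ x = x ≡ b
GadOld a b l₄ x = x ≡ a

gadOld? : ∀ a b i x → Dec (GadOld a b i x)
gadOld? a b l₁ x = no λ ()
gadOld? a b l₂ x = x ℕ.≟ a
gadOld? a b l₃ x = x ℕ.≟ b
gadOld? a b l₄ x = x ℕ.≟ a

CenGad : Pos → Set
CenGad l₁ = ⊤
CenGad _  = ⊥

cenGad? : ∀ i → Dec (CenGad i)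
cenGad? l₁ = yes tt
cenGad? l₂ = no λ ()
cenGad? l₃ = no λ ()
cenGad? l₄ = no λ ()

BAdj : DecGraph ℕ → BV → BV → Set
BAdj M (old x)     (old y)       = Adj M x y
BAdj M (old x)     cen           = ⊥
BAdj M (old x)     (gad a b i)   = GadOld a b i x
BAdj M cen         (old y)       = ⊥
BAdj M cen         cen           = ⊥
BAdj M cen         (gad a b i)   = CenGad i
BAdj M (gad a b i) (old y)       = GadOld a b i y
BAdj M (gad a b i) cen           = CenGad i
BAdj M (gad a b i) (gad a' b' j) = (a ≡ a' × b ≡ b') × CycAdj i j

BAdj? : (M : DecGraph ℕ) → ∀ x y → Dec (BAdj M x y)
BAdj? M (old x)     (old y)       = adj? M x y
BAdj? M (old x)     cen           = no λ ()
BAdj? M (old x)     (gad a b i)   = gadOld? a b i x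
BAdj? M cen         (old y)       = no λ ()
BAdj? M cen         cen           = no λ ()
BAdj? M cen         (gad a b i)   = cenGad? i
BAdj? M (gad a b i) (old y)       = gadOld? a b i y
BAdj? M (gad a b i) cen           = cenGad? i
BAdj? M (gad a b i) (gad a' b' j) = ((a ℕ.≟ a') ×-dec (b ℕ.≟ b')) ×-dec cyc? i j

-- the adjacency of B (restricted to the vertex set InB below)
BGraph : DecGraph ℕ → DecGraph BV
BGraph M = record { Adj = BAdj M ; adj? = BAdj? M }

InB : List ℕ → (ℕ → ℕ → Set) → BV → Set
InB A T (old x)     = x ∈ A
InB A T cen         = ⊤
InB A T (gad a b i) = a ∈ A × b ∈ A × T a b

{-# OPTIONS --safe #-}
module Submission where

-- Orient the edges of B at its new vertices: l₁ → c, l₁ → l₂, l₂ → l₃, l₂ → a, l₃ → l₄, l₃ → b,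
-- l₄ → l₁, l₄ → a.  Every l_i then has out-degree 2 and c has out-degree 0.  For A ⊊ C ⊆ B
-- with N = C ∖ A, each edge of C not inside A leaves a vertex of N, so |E_C| − |E_A| is at most
-- the sum of the out-degrees within C over N, hence at most 2|N|.  The bound is strict: either
-- c ∈ N, or walking from a vertex of N along l₂ → l₃ → l₄ → l₁ → c one leaves C, and the last
-- vertex in C has lost an out-neighbour.  Thus δ(C) − δ(A) = 2|N| − (|E_C| − |E_A|) > 0.

open import Defs
open import Data.Nat using (ℕ)
open import Data.Integer using (_<_)
open import Data.List using (List; map)
open import Data.List.Relation.Unary.Unique.Propositional using (Unique)
open import Data.List.Relation.Unary.All using (All)
open import Data.List.Relation.Binary.Subset.Propositional using (_⊆_)
open import Relation.Nullary using (¬_)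

import Data.Nat as ℕ
open import Data.Nat using (zero; suc; _+_; _*_; _≤_; z≤n; s≤s)
open import Data.Nat.Properties
  using (≤-trans; ≤-reflexive; +-mono-≤; +-mono-<-≤; +-mono-≤-<; +-monoˡ-≤; +-monoʳ-≤; +-monoʳ-<;
         m≤m+n; m≤n+m; *-suc; +-comm; +-identityʳ; *-distribˡ-+; +-commutativeSemigroup;
         module ≤-Reasoning)
open import Data.Nat.GeneralisedArithmetic using (iterate)
open import Data.Nat.ListAction using (sum)
open import Data.Nat.Tactic.RingSolver using (solve-∀)
import Data.Integer as ℤ
open import Data.Integer using (+_; _⊖_)
import Data.Integer.Properties as ℤᵖ
open import Data.Integer.Properties using (m-n≡m⊖n; +-cancelˡ-⊖; ⊖-monoʳ->-<)
open import Algebra.Properties.CommutativeSemigroup +-commutativeSemigroup using (interchange)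
open import Data.Bool using (Bool; true; false; T)
open import Data.List using ([]; _∷_; _++_; length; filter)
open import Data.List.Properties using (filter-++; length-++; filter-none)
open import Data.List.Relation.Unary.All as All using ([]; _∷_)
open import Data.List.Relation.Unary.All.Properties using (all-filter) renaming (map⁺ to All-map⁺)
open import Data.List.Relation.Unary.Any as Any using (Any; here; there)
open import Data.List.Relation.Unary.Any.Properties using (¬Any[])
open import Data.List.Relation.Unary.AllPairs using ([]; _∷_)
import Data.List.Relation.Unary.Unique.Propositional.Properties as Unique
open import Data.List.Membership.Propositional using (_∈_; _∉_; lose)
open import Data.List.Membership.Propositional.Properties
  using (∈-filter⁺; ∈-filter⁻; ∈-map⁺; ∈-++⁺ˡ; ∈-++⁺ʳ; ∈-++⁻)
open import Data.List.Membership.Propositional.Properties.WithK using (unique∧set⇒bag)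
open import Data.List.Relation.Binary.BagAndSetEquality using (∼bag⇒↭)
open import Data.List.Relation.Binary.Permutation.Propositional as ↭ using (_↭_)
open import Data.List.Relation.Binary.Permutation.Propositional.Properties using (↭-length; filter-↭)
open import Data.Product using (∃-syntax; _×_; _,_; proj₁; proj₂)
open import Data.Sum using (_⊎_; inj₁; inj₂; [_,_])
open import Data.Empty using (⊥; ⊥-elim)
open import Data.Unit using (tt)
open import Function.Bundles using (mk⇔)
open import Relation.Nullary using (Dec; yes; no)
open import Relation.Nullary.Decidable using (map′; _×-dec_; T?)
open import Relation.Unary using (Decidable; ∁)
open import Relation.Binary.Definitions using (DecidableEquality)
open import Relation.Binary.PropositionalEquality
  using (_≡_; refl; sym; trans; cong; cong₂; subst; module ≡-Reasoning)

𝟙 : {X : Set} → Dec X → ℕ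
𝟙 (yes _) = 1
𝟙 (no _)  = 0

𝟙-⇔ : {X Y : Set} → (X → Y) → (Y → X) → (x? : Dec X) (y? : Dec Y) → 𝟙 x? ≡ 𝟙 y?
𝟙-⇔ f g (yes _) (yes _) = refl
𝟙-⇔ f g (yes x) (no ¬y) = ⊥-elim (¬y (f x))
𝟙-⇔ f g (no ¬x) (yes y) = ⊥-elim (¬x (g y))
𝟙-⇔ f g (no _)  (no _)  = refl

𝟙-⊎ : {X Y Z : Set} → (X → Y ⊎ Z) → (x? : Dec X) (y? : Dec Y) (z? : Dec Z) → 𝟙 x? ≤ 𝟙 y? + 𝟙 z?
𝟙-⊎ split (no _)  _        _        = z≤n
𝟙-⊎ split (yes _) (yes _)  _        = s≤s z≤n
𝟙-⊎ split (yes _) (no _)   (yes _)  = s≤s z≤n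
𝟙-⊎ split (yes x) (no ¬y)  (no ¬z)  = ⊥-elim ([ ¬y , ¬z ] (split x))

module _ {A : Set} where

  count : {P : A → Set} → Decidable P → List A → ℕ
  count P? xs = length (filter P? xs)

  module _ {P : A → Set} (P? : Decidable P) where

    count-∷ : ∀ x xs → count P? (x ∷ xs) ≡ 𝟙 (P? x) + count P? xs
    count-∷ x xs with P? x
    ... | yes _ = refl
    ... | no  _ = refl

    count-≤-∷ : ∀ x xs → count P? xs ≤ count P? (x ∷ xs)
    count-≤-∷ x xs = ≤-trans (m≤n+m _ _) (≤-reflexive (sym (count-∷ x xs)))

    count-++ : ∀ xs ys → count P? (xs ++ ys) ≡ count P? xs + count P? ys
    count-++ xs ys = trans (cong length (filter-++ P? xs ys)) (length-++ (filter P? xs))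

    count-↭ : ∀ {xs ys} → xs ↭ ys → count P? xs ≡ count P? ys
    count-↭ p = ↭-length (filter-↭ P? p)

    count-none : ∀ {xs} → All (∁ P) xs → count P? xs ≡ 0
    count-none none = cong length (filter-none P? none)

  count-⊎ : {P Q R : A → Set} (P? : Decidable P) (Q? : Decidable Q) (R? : Decidable R) →
            (∀ {x} → P x → Q x ⊎ R x) → ∀ xs → count P? xs ≤ count Q? xs + count R? xs
  count-⊎ P? Q? R? split []       = z≤n
  count-⊎ P? Q? R? split (x ∷ xs) = begin
    count P? (x ∷ xs)
      ≡⟨ count-∷ P? x xs ⟩
    𝟙 (P? x) + count P? xs
      ≤⟨ +-mono-≤ (𝟙-⊎ split (P? x) (Q? x) (R? x)) (count-⊎ P? Q? R? split xs) ⟩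
    (𝟙 (Q? x) + 𝟙 (R? x)) + (count Q? xs + count R? xs)
      ≡⟨ interchange (𝟙 (Q? x)) (𝟙 (R? x)) (count Q? xs) (count R? xs) ⟩
    (𝟙 (Q? x) + count Q? xs) + (𝟙 (R? x) + count R? xs)
      ≡⟨ sym (cong₂ _+_ (count-∷ Q? x xs) (count-∷ R? x xs)) ⟩
    count Q? (x ∷ xs) + count R? (x ∷ xs) ∎
    where open ≤-Reasoning

  module _ (_≟_ : DecidableEquality A) where

    open import Data.List.Membership.DecPropositional _≟_ using (_∈?_)

    count-≡-≤1 : ∀ {xs} t → Unique xs → count (_≟ t) xs ≤ 1
    count-≡-≤1 t [] = z≤n
    count-≡-≤1 {x ∷ xs} t (x∉xs ∷ u) with x ≟ t
    ... | yes refl = s≤s (≤-reflexive (count-none (_≟ t) (All.map (λ x≢y y≡x → x≢y (sym y≡x)) x∉xs)))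
    ... | no  _    = count-≡-≤1 t u

    count-≡-∉ : ∀ {t xs} → t ∉ xs → count (_≟ t) xs ≡ 0
    count-≡-∉ {t} {xs} t∉xs = count-none (_≟ t) (All.tabulate λ y∈xs y≡t → t∉xs (subst (_∈ xs) y≡t y∈xs))

    count-∈-≤ : ∀ {xs} → Unique xs → ∀ ys → count (_∈? ys) xs ≤ length ys
    count-∈-≤ {xs} u []       = ≤-reflexive (count-none (_∈? []) {xs} (All.tabulate λ _ ()))
    count-∈-≤ {xs} u (y ∷ ys) =
      ≤-trans (count-⊎ (_∈? y ∷ ys) (_≟ y) (_∈? ys) Any.toSum xs)
              (+-mono-≤ (count-≡-≤1 y u) (count-∈-≤ u ys))

    count-∈-< : ∀ {xs} → Unique xs → ∀ {ys} → Any (_∉ xs) ys → count (_∈? ys) xs ℕ.< length ys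
    count-∈-< {xs} u {y ∷ ys} (here y∉xs) =
      s≤s (≤-trans (count-⊎ (_∈? y ∷ ys) (_≟ y) (_∈? ys) Any.toSum xs)
                   (+-mono-≤ (≤-reflexive (count-≡-∉ y∉xs)) (count-∈-≤ u ys)))
    count-∈-< {xs} u {y ∷ ys} (there p) =
      ≤-trans (s≤s (count-⊎ (_∈? y ∷ ys) (_≟ y) (_∈? ys) Any.toSum xs))
              (+-mono-≤-< (count-≡-≤1 y u) (count-∈-< u p))

module _ {A : Set} (f : A → ℕ) where

  sum-map-≡0 : ∀ {xs} → All (λ x → f x ≡ 0) xs → sum (map f xs) ≡ 0
  sum-map-≡0 []       = refl
  sum-map-≡0 (z ∷ zs) = cong₂ _+_ z (sum-map-≡0 zs)

  sum-map-≤-* : ∀ {k xs} → All (λ x → f x ≤ k) xs → sum (map f xs) ≤ k * length xs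
  sum-map-≤-* {k} []           = z≤n
  sum-map-≤-* {k} {_ ∷ xs} (p ∷ ps) =
    ≤-trans (+-mono-≤ p (sum-map-≤-* ps)) (≤-reflexive (sym (*-suc k (length xs))))

  sum-map-<-* : ∀ {k xs} → All (λ x → f x ≤ k) xs → Any (λ x → f x ℕ.< k) xs →
                sum (map f xs) ℕ.< k * length xs
  sum-map-<-* {k} {_ ∷ xs} (p ∷ ps) q =
    ≤-trans (step q) (≤-reflexive (sym (*-suc k (length xs))))
    where
    step : Any (λ x → f x ℕ.< k) (_ ∷ xs) → sum (map f (_ ∷ xs)) ℕ.< k + k * length xs
    step (here lt)  = +-mono-<-≤ lt (sum-map-≤-* ps)
    step (there lt) = +-mono-≤-< p (sum-map-<-* ps lt)

iterate-exit : {A : Set} {P : A → Set} → Decidable P → (f : A → A) → ∀ x n →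
               P x → ¬ P (iterate f x n) → ∃[ u ] P u × ¬ P (f u)
iterate-exit P? f x zero    px ¬pxₙ = ⊥-elim (¬pxₙ px)
iterate-exit P? f x (suc n) px ¬pxₙ with P? (f x)
... | yes pfx = iterate-exit P? f (f x) n pfx ¬pxₙ
... | no ¬pfx = x , px , ¬pfx

module _ {A : Set} {P : A → Set} (P? : Decidable P) where

  unique-filter-++ : ∀ {xs ys} → Unique xs → Unique ys → All (∁ P) ys → Unique (filter P? xs ++ ys)
  unique-filter-++ {xs} {ys} uxs uys ¬Pys = Unique.++⁺ (Unique.filter⁺ P? uxs) uys disjoint
    where
    disjoint : ∀ {x} → ¬ (x ∈ filter P? xs × x ∈ ys)
    disjoint (x∈ , x∈ys) = All.lookup ¬Pys x∈ys (proj₂ (∈-filter⁻ P? {xs = xs} x∈))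

  ↭-filter-++ : ∀ {xs ys} → Unique xs → Unique ys → All (∁ P) ys → ys ⊆ xs →
                (∀ {x} → x ∈ xs → ¬ P x → x ∈ ys) → xs ↭ filter P? xs ++ ys
  ↭-filter-++ {xs} {ys} uxs uys ¬Pys ys⊆xs rest =
    ∼bag⇒↭ (unique∧set⇒bag uxs (unique-filter-++ uxs uys ¬Pys) (mk⇔ to from))
    where
    to : ∀ {x} → x ∈ xs → x ∈ filter P? xs ++ ys
    to {x} x∈xs with P? x
    ... | yes px = ∈-++⁺ˡ (∈-filter⁺ P? x∈xs px)
    ... | no ¬px = ∈-++⁺ʳ (filter P? xs) (rest x∈xs ¬px)
    from : ∀ {x} → x ∈ filter P? xs ++ ys → x ∈ xs
    from x∈ with ∈-++⁻ (filter P? xs) x∈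
    ... | inj₁ x∈filter = proj₁ (∈-filter⁻ P? x∈filter)
    ... | inj₂ x∈ys     = ys⊆xs x∈ys

  filter-≢[] : ∀ {xs ys} → ¬ xs ⊆ ys → (∀ {x} → x ∈ xs → ¬ P x → x ∈ ys) → ¬ filter P? xs ≡ []
  filter-≢[] {xs} {ys} xs⊈ys rest filter≡[] = xs⊈ys xs⊆ys
    where
    xs⊆ys : xs ⊆ ys
    xs⊆ys {x} x∈xs with P? x
    ... | yes px = ⊥-elim (¬Any[] (subst (x ∈_) filter≡[] (∈-filter⁺ P? x∈xs px)))
    ... | no ¬px = rest x∈xs ¬px

module _ {V : Set} {O : V → V → Set} (O? : ∀ x → Decidable (O x)) where

  arcs : List V → List V → ℕ
  arcs xs ys = sum (map (λ x → count (O? x) ys) xs)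

  arcs-into-∷ : ∀ xs z zs → arcs xs (z ∷ zs) ≡ count (λ x → O? x z) xs + arcs xs zs
  arcs-into-∷ []       z zs = refl
  arcs-into-∷ (x ∷ xs) z zs = begin
    count (O? x) (z ∷ zs) + arcs xs (z ∷ zs)
      ≡⟨ cong₂ _+_ (count-∷ (O? x) z zs) (arcs-into-∷ xs z zs) ⟩
    (𝟙 (O? x z) + count (O? x) zs) + (count (λ y → O? y z) xs + arcs xs zs)
      ≡⟨ interchange (𝟙 (O? x z)) (count (O? x) zs) (count (λ y → O? y z) xs) (arcs xs zs) ⟩
    (𝟙 (O? x z) + count (λ y → O? y z) xs) + (count (O? x) zs + arcs xs zs)
      ≡⟨ cong (_+ _) (sym (count-∷ (λ y → O? y z) x xs)) ⟩
    count (λ y → O? y z) (x ∷ xs) + arcs (x ∷ xs) zs ∎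
    where open ≡-Reasoning

module _ {V : Set} (G : DecGraph V) where

  edges-↭ : (∀ {x y} → Adj G x y → Adj G y x) → ∀ {xs ys} → xs ↭ ys → edges G xs ≡ edges G ys
  edges-↭ adj-sym ↭.refl         = refl
  edges-↭ adj-sym (↭.prep x p)   = cong₂ _+_ (count-↭ (adj? G x) p) (edges-↭ adj-sym p)
  edges-↭ adj-sym (↭.trans p q)  = trans (edges-↭ adj-sym p) (edges-↭ adj-sym q)
  edges-↭ adj-sym (↭.swap {xs} {ys} x y p) = begin
    count (adj? G x) (y ∷ xs) + (count (adj? G y) xs + edges G xs)
      ≡⟨ cong (_+ _) (count-∷ (adj? G x) y xs) ⟩
    (𝟙 (adj? G x y) + count (adj? G x) xs) + (count (adj? G y) xs + edges G xs)
      ≡⟨ cong₂ _+_ (cong₂ _+_ (𝟙-⇔ adj-sym adj-sym (adj? G x y) (adj? G y x)) (count-↭ (adj? G x) p))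
                   (cong₂ _+_ (count-↭ (adj? G y) p) (edges-↭ adj-sym p)) ⟩
    (𝟙 (adj? G y x) + count (adj? G x) ys) + (count (adj? G y) ys + edges G ys)
      ≡⟨ interchange (𝟙 (adj? G y x)) (count (adj? G x) ys) (count (adj? G y) ys) (edges G ys) ⟩
    (𝟙 (adj? G y x) + count (adj? G y) ys) + (count (adj? G x) ys + edges G ys)
      ≡⟨ cong (_+ _) (sym (count-∷ (adj? G y) x ys)) ⟩
    count (adj? G y) (x ∷ ys) + (count (adj? G x) ys + edges G ys) ∎
    where open ≡-Reasoning

  -- Each edge meeting xs is an O-arc leaving xs or an O-arc from ys into xs.
  edges-++-≤ : {O : V → V → Set} (O? : ∀ x → Decidable (O x)) →
               (∀ {x y} → Adj G x y → O x y ⊎ O y x) → ∀ xs ys →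
               edges G (xs ++ ys) ≤ edges G ys + arcs O? xs (xs ++ ys) + arcs O? ys xs
  edges-++-≤ O? covers []       ys = ≤-trans (m≤m+n _ 0) (m≤m+n _ _)
  edges-++-≤ {O} O? covers (x ∷ xs) ys = begin
    count (adj? G x) L + edges G L
      ≤⟨ +-mono-≤ incident (edges-++-≤ O? covers xs ys) ⟩
    (count (O? x) L + (count into xs + count into ys)) + (edges G ys + arcs O? xs L + arcs O? ys xs)
      ≡⟨ rearrange (count (O? x) L) (count into xs) (count into ys) (edges G ys) (arcs O? xs L) (arcs O? ys xs) ⟩
    edges G ys + (count (O? x) L + (count into xs + arcs O? xs L)) + (count into ys + arcs O? ys xs)
      ≤⟨ +-monoˡ-≤ _ (+-monoʳ-≤ (edges G ys) (+-monoˡ-≤ _ (count-≤-∷ (O? x) x L))) ⟩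
    edges G ys + (count (O? x) (x ∷ L) + (count into xs + arcs O? xs L)) + (count into ys + arcs O? ys xs)
      ≡⟨ sym (cong₂ (λ p q → edges G ys + (count (O? x) (x ∷ L) + p) + q)
                    (arcs-into-∷ O? xs x L) (arcs-into-∷ O? ys x xs)) ⟩
    edges G ys + arcs O? (x ∷ xs) (x ∷ L) + arcs O? ys (x ∷ xs) ∎
    where
    open ≤-Reasoning
    L = xs ++ ys
    into : Decidable (λ y → O y x)
    into y = O? y x
    incident : count (adj? G x) L ≤ count (O? x) L + (count into xs + count into ys)
    incident = ≤-trans (count-⊎ (adj? G x) (O? x) into covers L)
                       (≤-reflexive (cong (count (O? x) L ℕ.+_) (count-++ into xs ys)))
    rearrange : ∀ a b c e p q → (a + (b + c)) + (e + p + q) ≡ e + (a + (b + p)) + (c + q)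
    rearrange = solve-∀

  δ-< : ∀ {xs ys} k → length ys ≡ k + length xs → edges G ys ℕ.< edges G xs + 2 * k → δ G xs < δ G ys
  δ-< {xs} {ys} k |ys| sparse = begin-strict
    + (2 * length xs) ℤ.- + edges G xs  ≡⟨ m-n≡m⊖n (2 * length xs) (edges G xs) ⟩
    2 * length xs ⊖ edges G xs          ≡⟨ +-cancelˡ-⊖ (2 * k) (2 * length xs) (edges G xs) ⟨
    (2 * k + 2 * length xs) ⊖ (2 * k + edges G xs)
      <⟨ ⊖-monoʳ->-< (2 * k + 2 * length xs) (subst (edges G ys ℕ.<_) (+-comm (edges G xs) (2 * k)) sparse) ⟩
    (2 * k + 2 * length xs) ⊖ edges G ys
      ≡⟨ cong (_⊖ edges G ys) (trans (sym (*-distribˡ-+ 2 k (length xs))) (cong (2 *_) (sym |ys|))) ⟩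
    2 * length ys ⊖ edges G ys          ≡⟨ m-n≡m⊖n (2 * length ys) (edges G ys) ⟨
    + (2 * length ys) ℤ.- + edges G ys  ∎
    where open ℤᵖ.≤-Reasoning

posIndex : Pos → ℕ
posIndex l₁ = 0
posIndex l₂ = 1
posIndex l₃ = 2
posIndex l₄ = 3

posIndex-injective : ∀ {i j} → posIndex i ≡ posIndex j → i ≡ j
posIndex-injective {l₁} {l₁} _ = refl
posIndex-injective {l₂} {l₂} _ = refl
posIndex-injective {l₃} {l₃} _ = refl
posIndex-injective {l₄} {l₄} _ = refl

_≟ᴾ_ : DecidableEquality Pos
i ≟ᴾ j = map′ posIndex-injective (cong posIndex) (posIndex i ℕ.≟ posIndex j)

_≟ᴮ_ : DecidableEquality BV
old x     ≟ᴮ old y       = map′ (cong old) (λ { refl → refl }) (x ℕ.≟ y)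
cen       ≟ᴮ cen         = yes refl
gad a b i ≟ᴮ gad a′ b′ j =
  map′ (λ { (refl , refl , refl) → refl }) (λ { refl → refl , refl , refl })
       (a ℕ.≟ a′ ×-dec b ℕ.≟ b′ ×-dec i ≟ᴾ j)
old _     ≟ᴮ cen         = no λ ()
old _     ≟ᴮ gad _ _ _   = no λ ()
cen       ≟ᴮ old _       = no λ ()
cen       ≟ᴮ gad _ _ _   = no λ ()
gad _ _ _ ≟ᴮ old _       = no λ ()
gad _ _ _ ≟ᴮ cen         = no λ ()

open import Data.List.Membership.DecPropositional _≟ᴮ_ using (_∈?_)

isNew : BV → Bool
isNew (old _)     = false
isNew cen         = true
isNew (gad _ _ _) = true

New : BV → Set
New v = T (isNew v)

new? : Decidable New
new? v = T? (isNew v)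

forward : BV → BV
forward (gad a b l₁) = cen
forward (gad a b l₂) = gad a b l₃
forward (gad a b l₃) = gad a b l₄
forward (gad a b l₄) = gad a b l₁
forward v            = v

forward⁴-new≡cen : ∀ v → New v → iterate forward v 4 ≡ cen
forward⁴-new≡cen cen          _ = refl
forward⁴-new≡cen (gad a b l₁) _ = refl
forward⁴-new≡cen (gad a b l₂) _ = refl
forward⁴-new≡cen (gad a b l₃) _ = refl
forward⁴-new≡cen (gad a b l₄) _ = refl

sideways : ℕ → ℕ → Pos → BV
sideways a b l₁ = gad a b l₂
sideways a b l₂ = old a
sideways a b l₃ = old b
sideways a b l₄ = old a

gadgetOut : ℕ → ℕ → Pos → List BV
gadgetOut a b i = forward (gad a b i) ∷ sideways a b i ∷ []

in-map-old : ∀ {A τ C x} → All (InB A τ) C → x ∈ C → ¬ New x → x ∈ map old A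
in-map-old {x = old _}     C⊆B x∈C _    = ∈-map⁺ old (All.lookup C⊆B x∈C)
in-map-old {x = cen}       _   _   ¬new = ⊥-elim (¬new tt)
in-map-old {x = gad _ _ _} _   _   ¬new = ⊥-elim (¬new tt)

CycAdj-sym : ∀ i j → CycAdj i j → CycAdj j i
CycAdj-sym l₁ l₂ _ = tt
CycAdj-sym l₂ l₁ _ = tt
CycAdj-sym l₂ l₃ _ = tt
CycAdj-sym l₃ l₂ _ = tt
CycAdj-sym l₃ l₄ _ = tt
CycAdj-sym l₄ l₃ _ = tt
CycAdj-sym l₄ l₁ _ = tt
CycAdj-sym l₁ l₄ _ = tt

module _ (M : DecGraph ℕ) where

  BAdj-sym : Simple M → ∀ {u v} → BAdj M u v → BAdj M v u
  BAdj-sym simple {old _}     {old _}       r = Simple.sym simple r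
  BAdj-sym simple {old _}     {gad _ _ _}   r = r
  BAdj-sym simple {cen}       {gad _ _ _}   r = r
  BAdj-sym simple {gad _ _ _} {old _}       r = r
  BAdj-sym simple {gad _ _ _} {cen}         r = r
  BAdj-sym simple {gad _ _ i} {gad _ _ j} ((refl , refl) , c) = (refl , refl) , CycAdj-sym i j c

  -- An orientation of B in which every l_i has out-degree 2 and c has out-degree 0; edges
  -- of M are oriented both ways, which is harmless since only edges meeting new vertices are counted.
  Out : BV → BV → Set
  Out (old x)     (old y)     = Adj M x y
  Out (old _)     cen         = ⊥
  Out (old _)     (gad _ _ _) = ⊥
  Out cen         _           = ⊥
  Out (gad a b i) v           = v ∈ gadgetOut a b i

  Out? : ∀ u → Decidable (Out u)
  Out? (old x)     (old y)     = adj? M x y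
  Out? (old _)     cen         = no λ ()
  Out? (old _)     (gad _ _ _) = no λ ()
  Out? cen         _           = no λ ()
  Out? (gad a b i) v           = v ∈? gadgetOut a b i

  anchored : ∀ {a b x} i → GadOld a b i x → old x ∈ gadgetOut a b i
  anchored l₂ x≡a = there (here (cong old x≡a))
  anchored l₃ x≡b = there (here (cong old x≡b))
  anchored l₄ x≡a = there (here (cong old x≡a))

  centred : ∀ {a b} i → CenGad i → cen ∈ gadgetOut a b i
  centred l₁ _ = here refl

  cycle-covers : ∀ {a b} i j → CycAdj i j → Out (gad a b i) (gad a b j) ⊎ Out (gad a b j) (gad a b i)
  cycle-covers l₁ l₂ _ = inj₁ (there (here refl))
  cycle-covers l₂ l₁ _ = inj₂ (there (here refl))
  cycle-covers l₂ l₃ _ = inj₁ (here refl)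
  cycle-covers l₃ l₂ _ = inj₂ (here refl)
  cycle-covers l₃ l₄ _ = inj₁ (here refl)
  cycle-covers l₄ l₃ _ = inj₂ (here refl)
  cycle-covers l₄ l₁ _ = inj₁ (here refl)
  cycle-covers l₁ l₄ _ = inj₂ (here refl)

  Out-covers : ∀ {u v} → BAdj M u v → Out u v ⊎ Out v u
  Out-covers {old _}     {old _}     r = inj₁ r
  Out-covers {old _}     {gad _ _ i} r = inj₂ (anchored i r)
  Out-covers {gad _ _ i} {old _}     r = inj₁ (anchored i r)
  Out-covers {cen}       {gad _ _ i} r = inj₂ (centred i r)
  Out-covers {gad _ _ i} {cen}       r = inj₁ (centred i r)
  Out-covers {gad _ _ i} {gad _ _ j} ((refl , refl) , c) = cycle-covers i j c

  no-Out-old→new : ∀ {x v} → New v → ¬ Out (old x) v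
  no-Out-old→new {v = old _} ()

  centre-outdegree : ∀ vs → count (Out? cen) vs ≡ 0
  centre-outdegree vs = count-none (Out? cen) {vs} (All.tabulate λ _ ())

  outdegree-≤ : ∀ {vs} → Unique vs → ∀ v → New v → count (Out? v) vs ≤ 2
  outdegree-≤ {vs} _   cen         _ = ≤-trans (≤-reflexive (centre-outdegree vs)) z≤n
  outdegree-≤      uvs (gad a b i) _ = count-∈-≤ _≟ᴮ_ uvs (gadgetOut a b i)

  outdegree-<-at-exit : ∀ {vs u} → Unique vs → u ∈ vs → forward u ∉ vs →
                        New u × count (Out? u) vs ℕ.< 2
  outdegree-<-at-exit {u = old _}     _   u∈vs fu∉vs = ⊥-elim (fu∉vs u∈vs)
  outdegree-<-at-exit {u = cen}       _   u∈vs fu∉vs = ⊥-elim (fu∉vs u∈vs)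
  outdegree-<-at-exit {u = gad _ _ _} uvs _    fu∉vs = tt , count-∈-< _≟ᴮ_ uvs (here fu∉vs)

  deficient-vertex : ∀ {vs v} → Unique vs → v ∈ vs → New v →
                     ∃[ u ] u ∈ vs × New u × count (Out? u) vs ℕ.< 2
  deficient-vertex {vs} {v} uvs v∈vs new with cen ∈? vs
  ... | yes cen∈vs = cen , cen∈vs , tt , subst (ℕ._< 2) (sym (centre-outdegree vs)) (s≤s z≤n)
  ... | no cen∉vs
    with u , u∈vs , fu∉vs ← iterate-exit (_∈? vs) forward v 4 v∈vs
                              (subst (_∉ vs) (sym (forward⁴-new≡cen v new)) cen∉vs)
    = u , u∈vs , outdegree-<-at-exit uvs u∈vs fu∉vs

  new-vertices-sparse : ∀ {ns os} → Unique (ns ++ os) → All New ns → All (∁ New) os → ¬ ns ≡ [] →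
                        edges (BGraph M) (ns ++ os) ℕ.< edges (BGraph M) os + 2 * length ns
  new-vertices-sparse {[]}     _ _ _ []≢[] = ⊥-elim ([]≢[] refl)
  new-vertices-sparse {n ∷ ns} {os} uL news olds _ = begin-strict
    edges B L                                       ≤⟨ edges-++-≤ B Out? (λ {u} {v} → Out-covers {u} {v}) (n ∷ ns) os ⟩
    edges B os + arcs Out? (n ∷ ns) L + arcs Out? os (n ∷ ns)
      ≡⟨ cong (edges B os + arcs Out? (n ∷ ns) L ℕ.+_) (sum-map-≡0 _ (All.map no-arcs-back olds)) ⟩
    edges B os + arcs Out? (n ∷ ns) L + 0           ≡⟨ +-identityʳ _ ⟩
    edges B os + arcs Out? (n ∷ ns) L
      <⟨ +-monoʳ-< (edges B os) (sum-map-<-* _ (All.map (λ {v} → outdegree-≤ uL v) news) deficient) ⟩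
    edges B os + 2 * length (n ∷ ns)                ∎
    where
    open ≤-Reasoning
    B = BGraph M
    L = (n ∷ ns) ++ os
    no-arcs-back : ∀ {o} → ¬ New o → count (Out? o) (n ∷ ns) ≡ 0
    no-arcs-back {old _}     _  = count-none (Out? (old _)) (All.map no-Out-old→new news)
    no-arcs-back {cen}       ¬n = ⊥-elim (¬n tt)
    no-arcs-back {gad _ _ _} ¬n = ⊥-elim (¬n tt)
    deficient : Any (λ v → count (Out? v) L ℕ.< 2) (n ∷ ns)
    deficient with u , u∈L , new-u , lt ← deficient-vertex uL (here refl) (All.head news)
      with ∈-++⁻ (n ∷ ns) u∈L
    ... | inj₁ u∈ns = lose u∈ns lt
    ... | inj₂ u∈os = ⊥-elim (All.lookup olds u∈os new-u)

lemma5p7 : (g : ℕ → ℕ) → AdmissibleCeil g →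
    (M : DecGraph ℕ) → Simple M → IsFraisseLimit g M →
    (T : ℕ → ℕ → Set) → TwoOrientation M T →
    (A : List ℕ) → Unique A → StrongInM M A →
    ∀ (C : List BV) → Unique C → All (InB A T) C →
    map old A ⊆ C → ¬ (C ⊆ map old A) →
    δ (BGraph M) (map old A) < δ (BGraph M) C
lemma5p7 _ _ M simple _ _ _ A uA _ C uC C⊆B A′⊆C C⊈A′ =
  δ-< B {A′} {C} (length N) |C| (begin-strict
    edges B C          ≡⟨ edges-↭ B (λ {u} {v} → BAdj-sym M simple {u} {v}) C↭N++A′ ⟩
    edges B (N ++ A′)  <⟨ new-vertices-sparse M (unique-filter-++ new? uC uA′ A′-old)
                                                (all-filter new? C) A′-old
                                                (filter-≢[] new? C⊈A′ (in-map-old C⊆B)) ⟩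
    edges B A′ + 2 * length N ∎)
  where
  open ≤-Reasoning
  B  = BGraph M
  A′ = map old A
  N  = filter new? C
  uA′ : Unique A′
  uA′ = Unique.map⁺ (λ { refl → refl }) uA
  A′-old : All (∁ New) A′
  A′-old = All-map⁺ (All.tabulate λ _ ())
  C↭N++A′ : C ↭ N ++ A′
  C↭N++A′ = ↭-filter-++ new? uC uA′ A′-old A′⊆C (in-map-old C⊆B)
  |C| : length C ≡ length N + length A′
  |C| = trans (↭-length C↭N++A′) (length-++ N)
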